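{- Let $n \ge 2$ and let $h$ be a non-decreasing integer-valued sequence with $h(1) = 1$ and $1 \le h(k+1)-h(k) \le 2$ for all $k$. Put $t(k) = (2^{n-1}-1)h(k) + k$ and $D_1 = \{t(k)\}_{k=1}^\infty$, $D_j = D_1 \pm 2^{n-2} \pm 2^{n-3}\pm\cdots\pm 2^{n-j}$ for $2 \le j \le n$. Then $D_1, \ldots, D_n$ partition the set of positive integers into $n$ pairwise disjoint sets.
   Context: For a set $X$ of integers and an integer $r$, $X \pm r = \{x+r : x\in X\}\cup\{x-r : x \in X\}$, iterated left to right. -}

module Defs where

open import Data.Nat using (ℕ; zero; suc; _∸_; _^_; _≤_)
open import Data.Integer using (ℤ; +_; _+_; _-_; _*_)
open import Data.Product using (Σ; ∃; _×_)
open import Data.Sum using (_⊎_)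
open import Data.Empty using (⊥)
open import Relation.Binary.PropositionalEquality using (_≡_)

-- t(k) = (2^{n-1} - 1) h(k) + k   (sequence h indexed from 1; h 0 is irrelevant)
t : ℕ → (ℕ → ℤ) → ℕ → ℤ
t n h k = ((+ (2 ^ (n ∸ 1))) - + 1) * h k + + k

-- D n h j x  means  x ∈ D_j.
-- D_1 = { t(k) : k ≥ 1 },
-- D_{j+1} = D_j ± 2^{n-(j+1)}  (for j ≥ 1), i.e. D_j = D_1 ± 2^{n-2} ± ... ± 2^{n-j}.
-- D_0 is not used (empty).
D : ℕ → (ℕ → ℤ) → ℕ → ℤ → Set
D n h zero x = ⊥
D n h (suc zero) x = Σ ℕ (λ k → (1 ≤ k) × (x ≡ t n h k))
D n h (suc (suc m)) x =
  Σ ℤ (λ y → D n h (suc m) y ×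
    ((x ≡ y + + (2 ^ (n ∸ suc (suc m)))) ⊎ (x ≡ y - + (2 ^ (n ∸ suc (suc m))))))

module Submission where

-- Write n = m + 1 and N = 2^m.  Shifting indices, t(k+1) = f(k) + N where
-- f(0) = 0 and f(k+1) - f(k) = (N - 1)(h(k+2) - h(k+1)) + 1 is either N
-- or 2N - 1.  Hence every positive integer is f(k) + u for a window k and
-- an offset 0 < u < 2N.  Unfolding the ± construction, D_{p+1} consists
-- exactly of the numbers f(k) + 2^(m-p)(2c+1) with c < 2^p, i.e. the
-- offsets of 2-adic valuation m - p.  So a positive integer lies in the D_j
-- selected by the valuation of its offset, and the D_j are disjoint because
-- two representations f(k) + u = f(k') + u' have offsets of equal valuation:
-- either k = k', or the windows are adjacent with step exactly N, so that
-- u = N + u' with u' < N.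

open import Defs
open import Data.Nat using (ℕ; suc; _≤_)
open import Data.Integer using (ℤ; +_; _-_; _<_) renaming (_≤_ to _≤ℤ_)
open import Data.Product using (Σ; _×_)
open import Relation.Binary.PropositionalEquality using (_≡_)

open import Data.Nat using (zero; _+_; _*_; _∸_; _^_; z≤n; s≤s; pred) renaming (_<_ to _<ₙ_)
open import Data.Nat.Properties
open import Data.Nat.Induction using (<-rec)
import Data.Nat.Tactic.RingSolver as ℕ-Solver
import Data.Integer as ℤ
open import Data.Integer using () renaming (_+_ to _+ℤ_; _*_ to _*ℤ_)
import Data.Integer.Properties as ℤP
import Data.Integer.Tactic.RingSolver as ℤ-Solver
open import Data.Product using (_,_; proj₁)
open import Data.Sum using (_⊎_; inj₁; inj₂)
open import Data.Empty using (⊥-elim)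
open import Relation.Nullary using (yes; no)
open import Relation.Binary.PropositionalEquality using (refl; sym; trans; cong; cong₂; subst; subst₂; module ≡-Reasoning)
open import Relation.Binary.Definitions using (tri<; tri≈; tri>)

odd : ℕ → ℕ
odd c = suc (2 * c)

parity : ∀ n → Σ ℕ (λ c → n ≡ 2 * c ⊎ n ≡ odd c)
parity zero = 0 , inj₁ refl
parity (suc n) with parity n
... | c , inj₁ e = c , inj₂ (cong suc e)
... | c , inj₂ e = suc c , inj₁ (trans (cong suc e) (sym (*-suc 2 c)))

power-≤-power-odd : ∀ s c → 2 ^ s ≤ 2 ^ s * odd c
power-≤-power-odd s c = m≤m*n (2 ^ s) (odd c)

power-odd-pos : ∀ s c → 0 <ₙ 2 ^ s * odd c
power-odd-pos s c = ≤-trans (m^n>0 2 s) (power-≤-power-odd s c)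

valuation-exists : ∀ u → 0 <ₙ u → Σ ℕ (λ s → Σ ℕ (λ c → u ≡ 2 ^ s * odd c))
valuation-exists = <-rec _ decompose
  where
  decompose : ∀ u → (∀ {v} → v <ₙ u → 0 <ₙ v → Σ ℕ (λ s → Σ ℕ (λ c → v ≡ 2 ^ s * odd c)))
            → 0 <ₙ u → Σ ℕ (λ s → Σ ℕ (λ c → u ≡ 2 ^ s * odd c))
  decompose u rec pos with parity u
  ... | c , inj₂ e = 0 , c , trans e (sym (*-identityˡ (odd c)))
  ... | zero , inj₁ e = ⊥-elim (<-irrefl (sym e) pos)
  ... | suc c , inj₁ e with rec (subst (suc c <ₙ_) (sym e) (m<m+n (suc c) (s≤s z≤n))) (s≤s z≤n)
  ...   | s , c′ , e′ = suc s , c′ , trans e (trans (cong (2 *_) e′) (sym (*-assoc 2 (2 ^ s) (odd c′))))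

valuation-unique : ∀ s s′ c c′ → 2 ^ s * odd c ≡ 2 ^ s′ * odd c′ → s ≡ s′
valuation-unique zero zero c c′ eq = refl
valuation-unique zero (suc s′) c c′ eq = ⊥-elim (even≢odd (2 ^ s′ * odd c′) c (begin
  2 * (2 ^ s′ * odd c′) ≡⟨ sym (*-assoc 2 (2 ^ s′) (odd c′)) ⟩
  2 ^ suc s′ * odd c′   ≡⟨ sym eq ⟩
  1 * odd c             ≡⟨ *-identityˡ (odd c) ⟩
  odd c                 ∎))
  where open ≡-Reasoning
valuation-unique (suc s) zero c c′ eq = sym (valuation-unique zero (suc s) c′ c (sym eq))
valuation-unique (suc s) (suc s′) c c′ eq = cong suc (valuation-unique s s′ c c′
  (*-cancelˡ-≡ _ _ 2 (trans (sym (*-assoc 2 (2 ^ s) (odd c))) (trans eq (*-assoc 2 (2 ^ s′) (odd c′))))))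

valuation-shift : ∀ m s c → s <ₙ m → Σ ℕ (λ c″ → 2 ^ m + 2 ^ s * odd c ≡ 2 ^ s * odd c″)
valuation-shift m s c s<m with m≤n⇒∃[o]m+o≡n s<m
... | d , refl = c + 2 ^ d , (begin
  2 ^ (suc s + d) + 2 ^ s * odd c     ≡⟨ cong (λ e → 2 * e + 2 ^ s * odd c) (^-distribˡ-+-* 2 s d) ⟩
  2 * (2 ^ s * 2 ^ d) + 2 ^ s * odd c ≡⟨ shift-identity (2 ^ s) (2 ^ d) c ⟩
  2 ^ s * odd (c + 2 ^ d)             ∎)
  where
  open ≡-Reasoning
  shift-identity : ∀ P Q c → 2 * (P * Q) + P * (1 + 2 * c) ≡ P * (1 + 2 * (c + Q))
  shift-identity = ℕ-Solver.solve-∀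

valuation-below : ∀ s k c → 2 ^ s * odd c <ₙ 2 ^ k → s <ₙ k
valuation-below s k c lt with s <? k
... | yes s<k = s<k
... | no s≮k = ⊥-elim (<⇒≱ lt (≤-trans (^-monoʳ-≤ 2 (≮⇒≥ s≮k)) (power-≤-power-odd s c)))

valuation-of-sum : ∀ m s s′ c c′ → 2 ^ s′ * odd c′ <ₙ 2 ^ m
  → 2 ^ s * odd c ≡ 2 ^ m + 2 ^ s′ * odd c′ → s ≡ s′
valuation-of-sum m s s′ c c′ u′<N eq with valuation-shift m s′ c′ (valuation-below s′ m c′ u′<N)
... | c″ , shifted = valuation-unique s s′ c c″ (trans eq shifted)

odd-< : ∀ {c k} → c <ₙ k → odd c <ₙ 2 * k
odd-< {c} {k} lt = subst (_≤ 2 * k) (*-suc 2 c) (*-monoʳ-≤ 2 lt)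

odd-<⁻¹ : ∀ {c k} → odd c <ₙ 2 * k → c <ₙ k
odd-<⁻¹ {c} {k} lt = *-cancelˡ-< 2 c k (<-trans (n<1+n (2 * c)) lt)

power-split : ∀ {m p} → p ≤ m → 2 ^ (m ∸ p) * 2 ^ suc p ≡ 2 ^ suc m
power-split {m} {p} p≤m = trans (sym (^-distribˡ-+-* 2 (m ∸ p) (suc p)))
  (cong (2 ^_) (trans (+-suc (m ∸ p) p) (cong suc (m∸n+n≡m p≤m))))

offset-bound : ∀ m p c → p ≤ m → c <ₙ 2 ^ p → 2 ^ (m ∸ p) * odd c <ₙ 2 ^ suc m
offset-bound m p c p≤m c< = subst (2 ^ (m ∸ p) * odd c <ₙ_) (power-split p≤m)
  (*-monoʳ-< (2 ^ (m ∸ p)) {{m^n≢0 2 (m ∸ p)}} (odd-< c<))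

offset-bound⁻¹ : ∀ m s c → 2 ^ s * odd c <ₙ 2 ^ suc m → s ≤ m × c <ₙ 2 ^ (m ∸ s)
offset-bound⁻¹ m s c lt = s≤m , odd-<⁻¹ (*-cancelˡ-< (2 ^ s) (odd c) (2 ^ suc (m ∸ s)) lt′)
  where
  s≤m : s ≤ m
  s≤m = ≤-pred (valuation-below s (suc m) c lt)
  lt′ : 2 ^ s * odd c <ₙ 2 ^ s * 2 ^ suc (m ∸ s)
  lt′ = subst (λ e → 2 ^ s * odd c <ₙ 2 ^ e * 2 ^ suc (m ∸ s)) (m∸[m∸n]≡n s≤m)
          (subst (2 ^ s * odd c <ₙ_) (sym (power-split (m∸n≤m m s))) lt)

refine-up : ∀ F s c → + (F + 2 ^ suc s * odd c) +ℤ + 2 ^ s ≡ + (F + 2 ^ s * odd (odd c))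
refine-up F s c = cong +_ (identity F (2 ^ s) c)
  where
  identity : ∀ F P c → F + 2 * P * (1 + 2 * c) + P ≡ F + P * (1 + 2 * (1 + 2 * c))
  identity = ℕ-Solver.solve-∀

refine-down : ∀ F s c → + (F + 2 ^ suc s * odd c) - + 2 ^ s ≡ + (F + 2 ^ s * odd (2 * c))
refine-down F s c = trans (cong (λ z → + z - + 2 ^ s) (identity F (2 ^ s) c))
  (cancel (+ (F + 2 ^ s * odd (2 * c))) (+ 2 ^ s))
  where
  identity : ∀ F P c → F + 2 * P * (1 + 2 * c) ≡ F + P * (1 + 2 * (2 * c)) + P
  identity = ℕ-Solver.solve-∀
  cancel : ∀ a p → (a +ℤ p) - p ≡ a
  cancel = ℤ-Solver.solve-∀

window-cover : (f : ℕ → ℕ) (W : ℕ) → (∀ k → f k <ₙ f (suc k)) → (∀ k → f (suc k) <ₙ f k + W)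
             → ∀ x → f 0 <ₙ x → Σ ℕ (λ k → f k <ₙ x × x <ₙ f k + W)
window-cover f W up small (suc x) f0<1+x with f 0 <? x
... | no f0≮x = 0 , f0<1+x , subst (λ y → suc y <ₙ f 0 + W) x≡f0 (≤-<-trans (up 0) (small 0))
  where
  x≡f0 : f 0 ≡ x
  x≡f0 = ≤-antisym (≤-pred f0<1+x) (≮⇒≥ f0≮x)
... | yes f0<x with window-cover f W up small x f0<x
...   | k , lo , hi with suc x <? f k + W
...     | yes inside = k , <-trans lo (n<1+n x) , inside
...     | no outside = suc k , <-≤-trans (small k) (≮⇒≥ outside) , ≤-<-trans hi (+-monoˡ-< W (up k))

module Windows (m : ℕ) (f : ℕ → ℕ)
  (step : ∀ k → f (suc k) ≡ f k + 2 ^ m ⊎ suc (f (suc k)) ≡ f k + 2 ^ suc m) where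

  N<2N : 2 ^ m <ₙ 2 ^ suc m
  N<2N = ^-monoʳ-< 2 (s≤s (s≤s z≤n)) (n<1+n m)

  step-≥ : ∀ k → f k + 2 ^ m ≤ f (suc k)
  step-≥ k with step k
  ... | inj₁ e = ≤-reflexive (sym e)
  ... | inj₂ e = ≤-pred (subst (f k + 2 ^ m <ₙ_) (sym e) (+-monoʳ-< (f k) N<2N))

  step-< : ∀ k → f (suc k) <ₙ f k + 2 ^ suc m
  step-< k with step k
  ... | inj₁ e = subst (_<ₙ f k + 2 ^ suc m) (sym e) (+-monoʳ-< (f k) N<2N)
  ... | inj₂ e = ≤-reflexive e

  increasing : ∀ k → f k <ₙ f (suc k)
  increasing k = <-≤-trans (m<m+n (f k) (m^n>0 2 m)) (step-≥ k)

  cover : ∀ x → f 0 <ₙ x → Σ ℕ (λ k → Σ ℕ (λ u → x ≡ f k + u × 0 <ₙ u × u <ₙ 2 ^ suc m))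
  cover x f0<x with window-cover f (2 ^ suc m) increasing step-< x f0<x
  ... | k , lo , hi = k , x ∸ f k , sym x≡ , m<n⇒0<n∸m lo , +-cancelˡ-< (f k) _ _ (subst (_<ₙ f k + 2 ^ suc m) (sym x≡) hi)
    where
    x≡ : f k + (x ∸ f k) ≡ x
    x≡ = m+[n∸m]≡n (<⇒≤ lo)

  later-window : ∀ k k′ → k <ₙ k′ → f k′ ≡ f k + 2 ^ m ⊎ f k + 2 ^ suc m ≤ suc (f k′)
  later-window k (suc k′) k<1+k′ with m≤n⇒m<n∨m≡n (≤-pred k<1+k′)
  ... | inj₂ refl with step k
  ...   | inj₁ e = inj₁ e
  ...   | inj₂ e = inj₂ (≤-reflexive (sym e))
  later-window k (suc k′) _ | inj₁ k<k′ with later-window k k′ k<k′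
  ...   | inj₂ far = inj₂ (≤-trans far (<⇒≤ (s≤s (increasing k′))))
  ...   | inj₁ near = inj₂ (≤-trans (≤-reflexive two-steps) (≤-trans (step-≥ k′) (n≤1+n (f (suc k′)))))
    where
    open ≡-Reasoning
    two-steps : f k + 2 ^ suc m ≡ f k′ + 2 ^ m
    two-steps = begin
      f k + (2 ^ m + (2 ^ m + 0)) ≡⟨ cong (λ z → f k + (2 ^ m + z)) (+-identityʳ (2 ^ m)) ⟩
      f k + (2 ^ m + 2 ^ m)       ≡⟨ sym (+-assoc (f k) (2 ^ m) (2 ^ m)) ⟩
      f k + 2 ^ m + 2 ^ m         ≡⟨ cong (_+ 2 ^ m) (sym near) ⟩
      f k′ + 2 ^ m                ∎

  -- If k < k′ and f k + u = f k′ + u′ with u < 2N, the windows are adjacent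
  -- with step N, so u = N + u′ and u, u′ have the same valuation.
  ordered-same-valuation : ∀ k k′ s s′ c c′ → k <ₙ k′ → 2 ^ s * odd c <ₙ 2 ^ suc m
    → f k + 2 ^ s * odd c ≡ f k′ + 2 ^ s′ * odd c′ → s ≡ s′
  ordered-same-valuation k k′ s s′ c c′ k<k′ u< eq with later-window k k′ k<k′
  ... | inj₂ far = ⊥-elim (<⇒≱ u< (+-cancelˡ-≤ (f k) _ _
        (≤-trans far (≤-trans (m<m+n (f k′) (power-odd-pos s′ c′)) (≤-reflexive (sym eq))))))
  ... | inj₁ near = valuation-of-sum m s s′ c c′ u′<N u≡
    where
    u≡ : 2 ^ s * odd c ≡ 2 ^ m + 2 ^ s′ * odd c′
    u≡ = +-cancelˡ-≡ (f k) _ _ (trans eq (trans (cong (_+ 2 ^ s′ * odd c′) near) (+-assoc (f k) (2 ^ m) _)))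
    u′<N : 2 ^ s′ * odd c′ <ₙ 2 ^ m
    u′<N = +-cancelˡ-< (2 ^ m) _ _ (subst₂ _<ₙ_ u≡ (cong (λ z → 2 ^ m + z) (+-identityʳ (2 ^ m))) u<)

  same-valuation : ∀ k k′ s s′ c c′ → 2 ^ s * odd c <ₙ 2 ^ suc m → 2 ^ s′ * odd c′ <ₙ 2 ^ suc m
    → f k + 2 ^ s * odd c ≡ f k′ + 2 ^ s′ * odd c′ → s ≡ s′
  same-valuation k k′ s s′ c c′ u< u′< eq with <-cmp k k′
  ... | tri< k<k′ _ _ = ordered-same-valuation k k′ s s′ c c′ k<k′ u< eq
  ... | tri≈ _ refl _ = valuation-unique s s′ c c′ (+-cancelˡ-≡ (f k) _ _ eq)
  ... | tri> _ _ k′<k = sym (ordered-same-valuation k′ k s′ s c′ c k′<k u′< (sym eq))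

one-or-two : ∀ d → + 1 ≤ℤ d → d ≤ℤ + 2 → d ≡ + 1 ⊎ d ≡ + 2
one-or-two (+ 0) (ℤ.+≤+ ()) _
one-or-two (+ 1) _ _ = inj₁ refl
one-or-two (+ 2) _ _ = inj₂ refl
one-or-two (+ suc (suc (suc d))) _ (ℤ.+≤+ (s≤s (s≤s ())))
one-or-two ℤ.-[1+ d ] () _

module FromIncrements (m : ℕ) (h : ℕ → ℤ) (h1 : h 1 ≡ + 1)
  (hd : ∀ k → 1 ≤ k → (+ 1 ≤ℤ h (suc k) - h k) × (h (suc k) - h k ≤ℤ + 2)) where

  -- N = 2^m = M + 1, so that 2^(n-1) - 1 = M for n = m + 1.
  M : ℕ
  M = pred (2 ^ m)

  N≡1+M : 2 ^ m ≡ suc M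
  N≡1+M = sym (suc-pred (2 ^ m) {{m^n≢0 2 m}})

  inc : ℕ → ℕ
  inc k = ℤ.∣ h (suc (suc k)) - h (suc k) ∣

  inc-one-or-two : ∀ k → inc k ≡ 1 ⊎ inc k ≡ 2
  inc-one-or-two k with hd (suc k) (s≤s z≤n)
  ... | lo , hi with one-or-two _ lo hi
  ...   | inj₁ e = inj₁ (cong ℤ.∣_∣ e)
  ...   | inj₂ e = inj₂ (cong ℤ.∣_∣ e)

  h-step : ∀ k → h (suc (suc k)) ≡ h (suc k) +ℤ + inc k
  h-step k = begin
    h (suc (suc k))                            ≡⟨ split-difference (h (suc (suc k))) (h (suc k)) ⟩
    h (suc k) +ℤ (h (suc (suc k)) - h (suc k)) ≡⟨ cong (h (suc k) +ℤ_) (sym (ℤP.0≤i⇒+∣i∣≡i nonneg)) ⟩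
    h (suc k) +ℤ + inc k                       ∎
    where
    open ≡-Reasoning
    split-difference : ∀ a b → a ≡ b +ℤ (a - b)
    split-difference = ℤ-Solver.solve-∀
    nonneg : + 0 ≤ℤ h (suc (suc k)) - h (suc k)
    nonneg = ℤP.≤-trans (ℤ.+≤+ z≤n) (proj₁ (hd (suc k) (s≤s z≤n)))

  -- The shifted positions f(k) = t(k+1) - N (see t-formula): f(0) = 0 and
  -- f(k+1) = f(k) + M·inc(k) + 1.
  f : ℕ → ℕ
  f zero = 0
  f (suc k) = f k + suc (M * inc k)

  f-step : ∀ k → f (suc k) ≡ f k + 2 ^ m ⊎ suc (f (suc k)) ≡ f k + 2 ^ suc m
  f-step k with inc-one-or-two k
  ... | inj₁ e = inj₁ (trans (cong (λ i → f k + suc (M * i)) e)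
                        (trans (single (f k) M) (cong (λ z → f k + z) (sym N≡1+M))))
    where
    single : ∀ F M → F + suc (M * 1) ≡ F + suc M
    single = ℕ-Solver.solve-∀
  ... | inj₂ e = inj₂ (trans (cong (λ i → suc (f k + suc (M * i))) e)
                        (trans (double (f k) M) (cong (λ N → f k + 2 * N) (sym N≡1+M))))
    where
    double : ∀ F M → suc (F + suc (M * 2)) ≡ F + 2 * suc M
    double = ℕ-Solver.solve-∀

  t-formula : ∀ k → t (suc m) h (suc k) ≡ + (f k + 2 ^ m)
  t-formula zero = trans (cong (λ y → (+ 2 ^ m - + 1) *ℤ y +ℤ + 1) h1) (first (+ 2 ^ m))
    where
    first : ∀ N → (N - + 1) *ℤ + 1 +ℤ + 1 ≡ N
    first = ℤ-Solver.solve-∀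
  t-formula (suc k) = begin
    A *ℤ h (suc (suc k)) +ℤ + suc (suc k)                ≡⟨ cong (λ y → A *ℤ y +ℤ + suc (suc k)) (h-step k) ⟩
    A *ℤ (h (suc k) +ℤ + inc k) +ℤ (+ 1 +ℤ + suc k)      ≡⟨ regroup A (h (suc k)) (+ inc k) (+ suc k) ⟩
    (A *ℤ h (suc k) +ℤ + suc k) +ℤ (A *ℤ + inc k +ℤ + 1) ≡⟨ cong₂ _+ℤ_ (t-formula k) (cong (λ a → a *ℤ + inc k +ℤ + 1) A≡M) ⟩
    + (f k + 2 ^ m) +ℤ (+ M *ℤ + inc k +ℤ + 1)           ≡⟨ cong (λ z → + (f k + 2 ^ m) +ℤ (z +ℤ + 1)) (sym (ℤP.pos-* M (inc k))) ⟩
    + (f k + 2 ^ m + (M * inc k + 1))                    ≡⟨ cong +_ (reorder (f k) (2 ^ m) (M * inc k)) ⟩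
    + (f (suc k) + 2 ^ m)                                ∎
    where
    open ≡-Reasoning
    A : ℤ
    A = + 2 ^ m - + 1
    A≡M : A ≡ + M
    A≡M = trans (cong (λ N → + N - + 1) N≡1+M) (drop-one (+ M))
      where
      drop-one : ∀ a → (+ 1 +ℤ a) - + 1 ≡ a
      drop-one = ℤ-Solver.solve-∀
    regroup : ∀ a x i k → a *ℤ (x +ℤ i) +ℤ (+ 1 +ℤ k) ≡ (a *ℤ x +ℤ k) +ℤ (a *ℤ i +ℤ + 1)
    regroup = ℤ-Solver.solve-∀
    reorder : ∀ F P X → F + P + (X + 1) ≡ F + suc X + P
    reorder = ℕ-Solver.solve-∀

  open Windows m f f-step

  OnLevel : ℕ → ℤ → Set
  OnLevel p x = Σ ℕ (λ k → Σ ℕ (λ c → c <ₙ 2 ^ p × x ≡ + (f k + 2 ^ (m ∸ p) * odd c)))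

  exponent-step : ∀ {p} → suc p ≤ m → ∀ k c
    → + (f k + 2 ^ (m ∸ p) * odd c) ≡ + (f k + 2 ^ suc (m ∸ suc p) * odd c)
  exponent-step le k c = cong (λ e → + (f k + 2 ^ e * odd c)) (+-∸-assoc 1 le)

  at-level-zero : ∀ k → + (f k + 2 ^ (m ∸ 0) * odd 0) ≡ t (suc m) h (suc k)
  at-level-zero k = trans (cong (λ z → + (f k + z)) (*-identityʳ (2 ^ m))) (sym (t-formula k))

  -- D_{p+1} is exactly level p.  By induction on p: the step ±2^(m-p-1)
  -- turns the odd part 2c+1 into 2(2c+1)+1 or 2(2c)+1, and conversely the
  -- parity of the new odd part recovers the predecessor on level p.
  D⇒level : ∀ p → p ≤ m → ∀ x → D (suc m) h (suc p) x → OnLevel p x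
  D⇒level zero _ x (zero , () , _)
  D⇒level zero _ x (suc k , _ , e) = k , 0 , s≤s z≤n , trans e (sym (at-level-zero k))
  D⇒level (suc p) le x (y , Dy , y±) with D⇒level p (<⇒≤ le) y Dy
  ... | k , c , c< , ey with y±
  ...   | inj₁ up = k , odd c , odd-< c< ,
          trans up (trans (cong (_+ℤ + 2 ^ (m ∸ suc p)) (trans ey (exponent-step le k c))) (refine-up (f k) (m ∸ suc p) c))
  ...   | inj₂ down = k , 2 * c , *-monoʳ-< 2 c< ,
          trans down (trans (cong (_- + 2 ^ (m ∸ suc p)) (trans ey (exponent-step le k c))) (refine-down (f k) (m ∸ suc p) c))

  level⇒D : ∀ p → p ≤ m → ∀ x → OnLevel p x → D (suc m) h (suc p) x
  level⇒D zero _ x (k , zero , _ , e) = suc k , s≤s z≤n , trans e (at-level-zero k)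
  level⇒D zero _ x (k , suc c , s≤s () , _)
  level⇒D (suc p) le x (k , c′ , c′< , e) with parity c′
  ... | c , inj₁ refl = y , level⇒D p (<⇒≤ le) y y-on-level , inj₂ (trans e (sym (refine-down (f k) (m ∸ suc p) c)))
    where
    y : ℤ
    y = + (f k + 2 ^ suc (m ∸ suc p) * odd c)
    y-on-level : OnLevel p y
    y-on-level = k , c , *-cancelˡ-< 2 c (2 ^ p) c′< , sym (exponent-step le k c)
  ... | c , inj₂ refl = y , level⇒D p (<⇒≤ le) y y-on-level , inj₁ (trans e (sym (refine-up (f k) (m ∸ suc p) c)))
    where
    y : ℤ
    y = + (f k + 2 ^ suc (m ∸ suc p) * odd c)
    y-on-level : OnLevel p y
    y-on-level = k , c , odd-<⁻¹ c′< , sym (exponent-step le k c)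

  D-positive : ∀ j → 1 ≤ j → j ≤ suc m → ∀ x → D (suc m) h j x → + 0 < x
  D-positive (suc p) _ (s≤s p≤m) x Dx with D⇒level p p≤m x Dx
  ... | k , c , _ , e = subst (+ 0 <_) (sym e) (ℤ.+<+ (≤-trans (power-odd-pos (m ∸ p) c) (m≤n+m _ (f k))))

  D-cover : ∀ x → + 0 < x → Σ ℕ (λ j → (1 ≤ j) × (j ≤ suc m) × D (suc m) h j x)
  D-cover (+ zero) (ℤ.+<+ ())
  D-cover (+ suc x) _ with cover (suc x) (s≤s z≤n)
  ... | k , u , x≡ , u>0 , u< with valuation-exists u u>0
  ...   | s , c , u≡ with offset-bound⁻¹ m s c (subst (_<ₙ 2 ^ suc m) u≡ u<)
  ...     | s≤m , c< = suc (m ∸ s) , s≤s z≤n , s≤s (m∸n≤m m s) ,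
            level⇒D (m ∸ s) (m∸n≤m m s) (+ suc x) (k , c , c< , cong +_ (trans x≡ (cong (λ z → f k + z) u≡′)))
    where
    u≡′ : u ≡ 2 ^ (m ∸ (m ∸ s)) * odd c
    u≡′ = trans u≡ (cong (λ e → 2 ^ e * odd c) (sym (m∸[m∸n]≡n s≤m)))

  -- The level of x is determined by the valuation of its offset.
  D-disjoint : ∀ i j → 1 ≤ i → i ≤ suc m → 1 ≤ j → j ≤ suc m → ∀ x → D (suc m) h i x → D (suc m) h j x → i ≡ j
  D-disjoint (suc p) (suc q) _ (s≤s p≤m) _ (s≤s q≤m) x Dx Dx′ with D⇒level p p≤m x Dx | D⇒level q q≤m x Dx′
  ... | k , c , c< , e | k′ , c′ , c′< , e′ = cong suc (∸-cancelˡ-≡ p≤m q≤m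
        (same-valuation k k′ _ _ c c′ (offset-bound m p c p≤m c<) (offset-bound m q c′ q≤m c′<) (ℤP.+-injective (trans (sym e) e′))))

-- D_1, …, D_n partition the positive integers (the proof only needs n ≥ 1;
-- monotonicity of h is implied by the bounds on its increments).

corollary2p3 : (n : ℕ) → 2 ≤ n → (h : ℕ → ℤ) → h 1 ≡ + 1
    → (∀ k → 1 ≤ k → h k ≤ℤ h (suc k))
    → (∀ k → 1 ≤ k → (+ 1 ≤ℤ h (suc k) - h k) × (h (suc k) - h k ≤ℤ + 2))
    → ((∀ j → 1 ≤ j → j ≤ n → ∀ x → D n h j x → + 0 < x)
    × (∀ x → + 0 < x → Σ ℕ (λ j → (1 ≤ j) × (j ≤ n) × D n h j x))
    × (∀ i j → 1 ≤ i → i ≤ n → 1 ≤ j → j ≤ n → ∀ x → D n h i x → D n h j x → i ≡ j))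
corollary2p3 (suc m) _ h h1 _ hd = D-positive , D-cover , D-disjoint
  where open FromIncrements m h h1 hd
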